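{- Let $r\ge 2$ and let $d\ge m$ be positive integers. Let $S_{d,m}$ be any $d$-vertex $r$-graph consisting of $m$ vertex-disjoint stars, each with vertex set of size $\lfloor d/m\rfloor$ or $\lceil d/m\rceil$ (the vertex sets of the stars partitioning the $d$ vertices). Then for every integer $s$ with $0\le s\le d$, the probability that a uniformly chosen set of $s$ vertices of $S_{d,m}$ is independent is at most \[ \exp\left(-\frac{m(s-rm)}{2d}\right). \]
   Context: An $r$-graph is a hypergraph all of whose edges have size $r$. A star with vertex set $V$ is the $r$-graph on $V$ whose edge set is $\{e\subset V: |e|=r,\ v\in e\}$ for some fixed vertex $v\in V$. A set of vertices is independent if it contains no edge. -}

module Defs where

open import Data.Nat using (ℕ; zero; suc; _+_; _*_; _∸_; _^_; _≤_; _≡ᵇ_; NonZero; _!)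
open import Data.Nat.ListAction using (sum)
open import Data.Bool.ListAction using (all; any)
open import Data.Nat.DivMod using (_/_)
open import Data.Nat.Combinatorics using (_P_)
open import Data.Integer using (ℤ; +_; -[1+_])
open import Data.Bool using (Bool; true; false; _∧_; _∨_; not)
open import Data.Fin using (Fin; _≟_)
open import Data.Fin.Subset using (Subset; ∣_∣)
open import Data.Vec using (Vec; []; _∷_; lookup)
open import Data.List using (List; []; _∷_; map; _++_; upTo; length; filterᵇ; allFin)
open import Data.Product using (∃)
open import Relation.Nullary.Decidable using (⌊_⌋)
open import Relation.Binary.PropositionalEquality using (_≡_)

⌈_/_⌉ : ℕ → (m : ℕ) → .{{NonZero m}} → ℕ
⌈ d / m ⌉ = (d + (m ∸ 1)) / m

allSubsets : (n : ℕ) → List (Subset n)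
allSubsets zero = [] ∷ []
allSubsets (suc n) = map (true ∷_) (allSubsets n) ++ map (false ∷_) (allSubsets n)

_⊆ᵇ_ : ∀ {n} → Subset n → Subset n → Bool
[] ⊆ᵇ [] = true
(x ∷ e) ⊆ᵇ (y ∷ a) = (not x ∨ y) ∧ (e ⊆ᵇ a)

-- An r-graph on Fin d given by a (boolean) edge predicate on subsets.
-- A set A of vertices is independent iff it contains no edge.
independentᵇ : ∀ {d} → (Subset d → Bool) → Subset d → Bool
independentᵇ {d} edge A = all (λ e → not (e ⊆ᵇ A ∧ edge e)) (allSubsets d)

numIndep : ∀ {d} → (Subset d → Bool) → ℕ → ℕ
numIndep {d} edge s =
  length (filterᵇ (λ A → (∣ A ∣ ≡ᵇ s) ∧ independentᵇ edge A) (allSubsets d))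

-- Vertex classes: part : Fin d → Fin m assigns each vertex to its star;
-- star i has vertex set V_i = part⁻¹(i) and centre `centre i` ∈ V_i.
starsEdgeᵇ : ∀ {d m} → (r : ℕ) → (Fin d → Fin m) → (Fin m → Fin d) → Subset d → Bool
starsEdgeᵇ {d} {m} r part centre e =
  (∣ e ∣ ≡ᵇ r) ∧
  any (λ i → lookup e (centre i) ∧ all (λ v → not (lookup e v) ∨ ⌊ part v ≟ i ⌋) (allFin d))
      (allFin m)

classSize : ∀ {d m} → (Fin d → Fin m) → Fin m → ℕ
classSize {d} part i = length (filterᵇ (λ v → ⌊ part v ≟ i ⌋) (allFin d))

-- Rational lower approximations of e:  e_N = Σ_{j=0}^{N} 1/j!  =  eNum N / N!
-- with eNum N = Σ_{j=0}^{N} N!/j!  (N!/j! = N P (N ∸ j)).  e_N ↑ e.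
eNum : ℕ → ℕ
eNum N = sum (map (λ j → N P (N ∸ j)) (upTo (suc N)))

-- LeExp a b z  means  a ≤ b · exp(z)  (a, b natural numbers, z an integer),
-- expressed via the partial sums e_N ↑ e (e irrational, so no boundary issues):
--   z = k ≥ 0 :  a ≤ b e^k      ⟺  ∃ N, a · (N!)^k ≤ b · (eNum N)^k
--   z = -k < 0 :  a e^k ≤ b      ⟺  ∀ N, a · (eNum N)^k ≤ b · (N!)^k
LeExp : ℕ → ℕ → ℤ → Set
LeExp a b (+ k) = ∃ λ N → a * (N !) ^ k ≤ b * eNum N ^ k
LeExp a b -[1+ k ] = ∀ N → a * eNum N ^ suc k ≤ b * (N !) ^ suc k

module Submission where

-- Let V₁, …, Vₘ be the vertex classes of the stars, cᵢ ∈ Vᵢ their centres, nᵢ = |Vᵢ| ≤ q + 1 with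
-- q = ⌊d/m⌋, and aᵢ(A) = |A ∩ Vᵢ|.  A set A is independent iff for every i, cᵢ ∉ A or aᵢ(A) < r.
-- Swapping cᵢ with another vertex of Vᵢ permutes the s-sets and preserves every aⱼ and the condition
-- of every other star, so averaging over this relabelling turns the weight nᵢ·[cᵢ ∉ A ∨ aᵢ(A) < r]
-- into nᵢ − aᵢ(A)·[aᵢ(A) ≥ r].  Doing this one star at a time gives
--   (∏ nᵢ) · #{independent s-sets} ≤ Σ_{|A| = s} ∏ᵢ (nᵢ − aᵢ(A)·[aᵢ(A) ≥ r]).
-- As nᵢ ≤ q + 1, (1 − a/nᵢ)^{2q} ≤ 3^{−a}, so each summand is at most (∏ nᵢ)·3^{−(s − rm)/(2q)}, and
-- 3^{−(s − rm)/(2q)} ≤ e^{−m(s − rm)/(2d)} because qm ≤ d.  Everything is raised to the power 2d to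
-- stay in ℕ; the sum over A is then bounded termwise via (x + x′)/(y + y′) ≤ max(x/y, x′/y′).

open import Defs
open import Data.Nat using (ℕ; zero; suc; NonZero; >-nonZero; >-nonZero⁻¹; _+_; _*_; _^_; _∸_; _/_; _!;
  _≤_; _≤?_; _<?_; _≤ᵇ_; _≡ᵇ_; z≤n; s≤s; s≤s⁻¹)
open import Data.Nat.Properties hiding (_≟_)
open import Data.Nat.Combinatorics using (_C_; _P_; nCk+nC[k+1]≡[n+1]C[k+1])
open import Data.Nat.Combinatorics.Base using (_P′_)
open import Data.Nat.DivMod using (/-monoˡ-≤; m/n≡1+[m∸n]/n; m≥n⇒m/n>0; m/n*n≤m)
open import Data.Nat.ListAction using (sum)
open import Data.Nat.ListAction.Properties using (sum-++)
open import Data.Nat.Tactic.RingSolver using (solve-∀)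
open import Data.Integer using (+_; -_) renaming (_*_ to _*ℤ_; _-_ to _-ℤ_)
import Data.Integer.Properties as ℤ
open import Data.Bool using (Bool; true; false; _∧_; _∨_; not; if_then_else_; T)
open import Data.Bool.Properties using (T-≡; T-∧; T-not-≡)
open import Data.Unit using (tt)
open import Data.Product using (∃; _×_; _,_; proj₁; proj₂)
open import Data.Sum using (_⊎_; inj₁; inj₂)
open import Data.Fin using (Fin; zero; suc; _≟_; toℕ; inject₁; fromℕ; fromℕ<; punchIn)
import Data.Fin.Properties as Finₚ
open import Data.Fin.Properties using (toℕ-fromℕ; toℕ-fromℕ<; toℕ-inject₁; toℕ≤pred[n]; toℕ<n; punchInᵢ≢i)
open import Data.Fin.Permutation using (transpose)
import Data.Fin.Permutation.Components as PC
open import Data.Fin.Subset using (Subset; ∣_∣; _∈_; _⊆_; inside; outside)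
open import Data.Fin.Subset.Properties using (drop-∷-⊆; out⊆; in⊆in; ⊆-refl; x∈⁅x⁆; x∈⁅y⁆⇒x≡y; ∣⁅x⁆∣≡1)
open import Data.Vec using (Vec; []; _∷_; lookup; insertAt; _[_]≔_; here)
import Data.Vec as Vec
open import Data.Vec.Properties
  using ([]=⇒lookup; lookup⇒[]=; lookup∘tabulate; lookup∘update; lookup∘update′; insertAt-lookup; []≔-commutes)
open import Data.Vec.Functional using (removeAt)
open import Data.List using ([]; _∷_; map; _++_; length; filterᵇ; tabulate; applyUpTo; allFin)
open import Data.List.Properties using (map-++; map-∘)
open import Data.List.Membership.Propositional using () renaming (_∈_ to _∈ᴸ_)
open import Data.List.Membership.Propositional.Properties using (∈-map⁺; ∈-++⁺ˡ; ∈-++⁺ʳ)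
open import Data.List.Relation.Unary.Any using (here)
import Data.List.Relation.Unary.All as All
open import Data.List.Relation.Unary.All.Properties using (all⁺; all⁻)
import Data.List.Relation.Unary.All.Properties as Allₚ
open import Data.List.Relation.Unary.Any.Properties using (any⁺)
import Data.List.Relation.Unary.Any.Properties as Anyₚ
open import Function using (_∘_)
open import Function.Bundles using (mk⇔; Equivalence)
open import Relation.Nullary using (yes; no; does; contradiction)
open import Relation.Nullary.Decidable using (⌊_⌋; dec-true; dec-false; isYes≗does; does-⇔)
open import Relation.Binary.PropositionalEquality
open import Algebra.Properties.CommutativeSemigroup +-commutativeSemigroup using (interchange)
open import Algebra.Properties.CommutativeSemigroup *-commutativeSemigroup
  using () renaming (x∙yz≈y∙xz to x*[y*z]≡y*[x*z]; xy∙z≈y∙xz to x*y*z≡y*[x*z]; xy∙z≈xz∙y to x*y*z≡x*z*y; x∙yz≈xz∙y to x*[y*z]≡x*z*y)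
open import Algebra.Properties.Semiring.Sum +-*-semiring
  using (*-distribˡ-sum; *-distribʳ-sum; ∑-distrib-+; ∑-comm; sum-permute; sum-cong-≗; sum-replicate-zero; sum-init-last)
  renaming (sum to ∑)
open import Algebra.Properties.CommutativeMonoid.Sum *-1-commutativeMonoid
  using ()
  renaming (sum to ∏; ∑-distrib-+ to ∏-distrib-*; sum-remove to ∏-remove; sum-cong-≗ to ∏-cong)

-- Indicators and finite sums

⟦_⟧ : Bool → ℕ
⟦ true ⟧ = 1
⟦ false ⟧ = 0

⟦⟧≤1 : ∀ b → ⟦ b ⟧ ≤ 1
⟦⟧≤1 true = ≤-refl
⟦⟧≤1 false = z≤n

⟦∧⟧ : ∀ x y → ⟦ x ∧ y ⟧ ≡ ⟦ x ⟧ * ⟦ y ⟧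
⟦∧⟧ true y = sym (+-identityʳ ⟦ y ⟧)
⟦∧⟧ false y = refl

⟦∧⟧≤ˡ : ∀ x y → ⟦ x ∧ y ⟧ ≤ ⟦ x ⟧
⟦∧⟧≤ˡ true y = ⟦⟧≤1 y
⟦∧⟧≤ˡ false y = z≤n

⟦not-∧⟧-complement : ∀ g n x b → g * (n * ⟦ not (x ∧ b) ⟧) + n * (g * ⟦ b ⟧ * ⟦ x ⟧) ≡ g * n
⟦not-∧⟧-complement g n x b = begin
  g * (n * ⟦ not (x ∧ b) ⟧) + n * (g * ⟦ b ⟧ * ⟦ x ⟧)  ≡⟨ collect g n ⟦ not (x ∧ b) ⟧ ⟦ b ⟧ ⟦ x ⟧ ⟩
  g * n * (⟦ not (x ∧ b) ⟧ + ⟦ b ⟧ * ⟦ x ⟧)            ≡⟨ cong (_*_ (g * n)) (⟦not[x∧b]⟧+⟦b⟧*⟦x⟧≡1 x b) ⟩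
  g * n * 1                                            ≡⟨ *-identityʳ (g * n) ⟩
  g * n                                                ∎
  where
  open ≡-Reasoning
  collect : ∀ g n p b x → g * (n * p) + n * (g * b * x) ≡ g * n * (p + b * x)
  collect = solve-∀
  ⟦not[x∧b]⟧+⟦b⟧*⟦x⟧≡1 : ∀ x b → ⟦ not (x ∧ b) ⟧ + ⟦ b ⟧ * ⟦ x ⟧ ≡ 1
  ⟦not[x∧b]⟧+⟦b⟧*⟦x⟧≡1 true true = refl
  ⟦not[x∧b]⟧+⟦b⟧*⟦x⟧≡1 true false = refl
  ⟦not[x∧b]⟧+⟦b⟧*⟦x⟧≡1 false true = refl
  ⟦not[x∧b]⟧+⟦b⟧*⟦x⟧≡1 false false = refl

∸-if-complement : ∀ {a n} g b → a ≤ n → g * (n ∸ (if b then a else 0)) + g * ⟦ b ⟧ * a ≡ g * n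
∸-if-complement {a} {n} g true a≤n = begin
  g * (n ∸ a) + g * 1 * a  ≡⟨ cong (λ h → g * (n ∸ a) + h * a) (*-identityʳ g) ⟩
  g * (n ∸ a) + g * a      ≡⟨ *-distribˡ-+ g (n ∸ a) a ⟨
  g * (n ∸ a + a)          ≡⟨ cong (_*_ g) (m∸n+n≡m a≤n) ⟩
  g * n                    ∎
  where open ≡-Reasoning
∸-if-complement {a} {n} g false _ = trans (cong (λ h → g * n + h * a) (*-zeroʳ g)) (+-identityʳ (g * n))

δ : ∀ {n} → Fin n → Fin n → Bool
δ i k = ⌊ i ≟ k ⌋

δ-refl : ∀ {n} (i : Fin n) → δ i i ≡ true
δ-refl i = trans (isYes≗does (i ≟ i)) (dec-true (i ≟ i) refl)

δ≡true⇒≡ : ∀ {n} {i k : Fin n} → δ i k ≡ true → i ≡ k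
δ≡true⇒≡ {i = i} {k} e with i ≟ k
... | yes i≡k = i≡k
δ≡true⇒≡ () | no _

δ≡false⇒≢ : ∀ {n} {i k : Fin n} → δ i k ≡ false → i ≢ k
δ≡false⇒≢ {i = i} {k} e with i ≟ k
δ≡false⇒≢ () | yes _
... | no i≢k = i≢k

δ≢ : ∀ {n} {i k : Fin n} → i ≢ k → δ i k ≡ false
δ≢ {i = i} {k} i≢k = trans (isYes≗does (i ≟ k)) (dec-false (i ≟ k) i≢k)

δ-suc : ∀ {n} (i k : Fin n) → δ (suc i) (suc k) ≡ δ i k
δ-suc i k = trans (isYes≗does (suc i ≟ suc k))
  (trans (does-⇔ (mk⇔ Finₚ.suc-injective (cong suc)) (suc i ≟ suc k) (i ≟ k)) (sym (isYes≗does (i ≟ k))))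

∑-mono : ∀ {n} {f g : Fin n → ℕ} → (∀ i → f i ≤ g i) → ∑ f ≤ ∑ g
∑-mono {zero} f≤g = z≤n
∑-mono {suc n} f≤g = +-mono-≤ (f≤g zero) (∑-mono (f≤g ∘ suc))

∑-single : ∀ {n} (f : Fin n → ℕ) i → f i ≤ ∑ f
∑-single f zero = m≤m+n _ _
∑-single f (suc i) = ≤-trans (∑-single (f ∘ suc) i) (m≤n+m _ _)

∑-δ : ∀ {n} (i : Fin n) → ∑ (λ k → ⟦ δ i k ⟧) ≡ 1
∑-δ {suc n} zero = cong suc (sum-replicate-zero n)
∑-δ (suc i) = trans (sum-cong-≗ (λ k → cong ⟦_⟧ (δ-suc i k))) (∑-δ i)

∏-mono : ∀ {n} {f g : Fin n → ℕ} → (∀ i → f i ≤ g i) → ∏ f ≤ ∏ g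
∏-mono {zero} f≤g = ≤-refl
∏-mono {suc n} f≤g = *-mono-≤ (f≤g zero) (∏-mono (f≤g ∘ suc))

∏-const : ∀ n c → ∏ {n} (λ _ → c) ≡ c ^ n
∏-const zero c = refl
∏-const (suc n) c = cong (c *_) (∏-const n c)

∏-^ : ∀ {n} (f : Fin n → ℕ) k → ∏ (λ i → f i ^ k) ≡ ∏ f ^ k
∏-^ {n} f zero = trans (∏-const n 1) (^-zeroˡ n)
∏-^ f (suc k) = trans (∏-distrib-* f (λ i → f i ^ k)) (cong (∏ f *_) (∏-^ f k))

∏-^-∑ : ∀ {n} b (f : Fin n → ℕ) → ∏ (λ i → b ^ f i) ≡ b ^ ∑ f
∏-^-∑ {zero} b f = refl
∏-^-∑ {suc n} b f = trans (cong (b ^ f zero *_) (∏-^-∑ b (f ∘ suc))) (sym (^-distribˡ-+-* b (f zero) _))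

∏-except : ∀ {n} (t : Fin n → ℕ) k → ∏ t ≡ t k * ∏ (λ i → if δ i k then 1 else t i)
∏-except {suc n} t k = begin
  ∏ t
    ≡⟨ ∏-remove {i = k} t ⟩
  t k * ∏ (removeAt t k)
    ≡⟨ cong (_*_ (t k)) (∏-cong (λ j → cong (λ b → if b then 1 else t (punchIn k j)) (δ≢ (punchInᵢ≢i k j)))) ⟨
  t k * ∏ (removeAt tₖ k)
    ≡⟨ cong (_*_ (t k)) ∏tₖ≡∏[removeAt-tₖ] ⟨
  t k * ∏ tₖ ∎
  where
  open ≡-Reasoning
  tₖ : Fin (suc n) → ℕ
  tₖ i = if δ i k then 1 else t i
  ∏tₖ≡∏[removeAt-tₖ] : ∏ tₖ ≡ ∏ (removeAt tₖ k)
  ∏tₖ≡∏[removeAt-tₖ] = begin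
    ∏ tₖ                       ≡⟨ ∏-remove {i = k} tₖ ⟩
    tₖ k * ∏ (removeAt tₖ k)   ≡⟨ cong (λ b → (if b then 1 else t k) * ∏ (removeAt tₖ k)) (δ-refl k) ⟩
    1 * ∏ (removeAt tₖ k)      ≡⟨ *-identityˡ _ ⟩
    ∏ (removeAt tₖ k)          ∎

^-distribʳ-* : ∀ a b n → (a * b) ^ n ≡ a ^ n * b ^ n
^-distribʳ-* a b n = begin
  (a * b) ^ n                         ≡⟨ ∏-const n (a * b) ⟨
  ∏ {n} (λ _ → a * b)                 ≡⟨ ∏-distrib-* {n} (λ _ → a) (λ _ → b) ⟩
  ∏ {n} (λ _ → a) * ∏ {n} (λ _ → b)   ≡⟨ cong₂ _*_ (∏-const n a) (∏-const n b) ⟩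
  a ^ n * b ^ n                       ∎
  where open ≡-Reasoning

-- Sums over all subsets

∑ₛ : ∀ n → (Vec Bool n → ℕ) → ℕ
∑ₛ zero F = F []
∑ₛ (suc n) F = ∑ₛ n (F ∘ (true ∷_)) + ∑ₛ n (F ∘ (false ∷_))

∑ₛ-cong : ∀ n {F G : Vec Bool n → ℕ} → (∀ A → F A ≡ G A) → ∑ₛ n F ≡ ∑ₛ n G
∑ₛ-cong zero F≗G = F≗G []
∑ₛ-cong (suc n) F≗G = cong₂ _+_ (∑ₛ-cong n (F≗G ∘ (true ∷_))) (∑ₛ-cong n (F≗G ∘ (false ∷_)))

∑ₛ-mono : ∀ n {F G : Vec Bool n → ℕ} → (∀ A → F A ≤ G A) → ∑ₛ n F ≤ ∑ₛ n G
∑ₛ-mono zero F≤G = F≤G []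
∑ₛ-mono (suc n) F≤G = +-mono-≤ (∑ₛ-mono n (F≤G ∘ (true ∷_))) (∑ₛ-mono n (F≤G ∘ (false ∷_)))

∑ₛ-zero : ∀ n → ∑ₛ n (λ _ → 0) ≡ 0
∑ₛ-zero zero = refl
∑ₛ-zero (suc n) = cong₂ _+_ (∑ₛ-zero n) (∑ₛ-zero n)

∑ₛ-distrib-+ : ∀ n (F G : Vec Bool n → ℕ) → ∑ₛ n (λ A → F A + G A) ≡ ∑ₛ n F + ∑ₛ n G
∑ₛ-distrib-+ zero F G = refl
∑ₛ-distrib-+ (suc n) F G =
  trans (cong₂ _+_ (∑ₛ-distrib-+ n (F ∘ (true ∷_)) (G ∘ (true ∷_))) (∑ₛ-distrib-+ n (F ∘ (false ∷_)) (G ∘ (false ∷_))))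
        (interchange (∑ₛ n (F ∘ (true ∷_))) (∑ₛ n (G ∘ (true ∷_))) (∑ₛ n (F ∘ (false ∷_))) (∑ₛ n (G ∘ (false ∷_))))

*-distribˡ-∑ₛ : ∀ n c (F : Vec Bool n → ℕ) → c * ∑ₛ n F ≡ ∑ₛ n (λ A → c * F A)
*-distribˡ-∑ₛ zero c F = refl
*-distribˡ-∑ₛ (suc n) c F = trans (*-distribˡ-+ c _ _) (cong₂ _+_ (*-distribˡ-∑ₛ n c _) (*-distribˡ-∑ₛ n c _))

∑ₛ-∑-comm : ∀ n {k} (F : Fin k → Vec Bool n → ℕ) → ∑ₛ n (λ A → ∑ (λ u → F u A)) ≡ ∑ (λ u → ∑ₛ n (F u))
∑ₛ-∑-comm zero F = refl
∑ₛ-∑-comm (suc n) F =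
  trans (cong₂ _+_ (∑ₛ-∑-comm n (λ u → F u ∘ (true ∷_))) (∑ₛ-∑-comm n (λ u → F u ∘ (false ∷_))))
        (sym (∑-distrib-+ (λ u → ∑ₛ n (F u ∘ (true ∷_))) (λ u → ∑ₛ n (F u ∘ (false ∷_)))))

∑ₛ-insertAt : ∀ n (j : Fin (suc n)) (F : Vec Bool (suc n) → ℕ) →
  ∑ₛ (suc n) F ≡ ∑ₛ n (λ A → F (insertAt A j true)) + ∑ₛ n (λ A → F (insertAt A j false))
∑ₛ-insertAt n zero F = refl
∑ₛ-insertAt (suc n) (suc j) F =
  trans (cong₂ _+_ (∑ₛ-insertAt n j (F ∘ (true ∷_))) (∑ₛ-insertAt n j (F ∘ (false ∷_))))
        (interchange (U true true) (U true false) (U false true) (U false false))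
  where
  U : Bool → Bool → ℕ
  U b c = ∑ₛ n (λ A → F (b ∷ insertAt A j c))

swap : ∀ {n} → Fin n → Fin n → Vec Bool n → Vec Bool n
swap v w A = (A [ v ]≔ lookup A w) [ w ]≔ lookup A v

swap-comm : ∀ {n} (v w : Fin n) (A : Vec Bool n) → swap v w A ≡ swap w v A
swap-comm v w A with v ≟ w
... | yes refl = refl
... | no v≢w = []≔-commutes A v w v≢w

lookup-swap-at : ∀ {n} (v w : Fin n) (A : Vec Bool n) → lookup (swap v w A) w ≡ lookup A v
lookup-swap-at v w A = lookup∘update w (A [ v ]≔ lookup A w) (lookup A v)

lookup-swap-other : ∀ {n} (v w : Fin n) (A : Vec Bool n) {u} → u ≢ v → u ≢ w → lookup (swap v w A) u ≡ lookup A u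
lookup-swap-other v w A u≢v u≢w =
  trans (lookup∘update′ u≢w (A [ v ]≔ lookup A w) (lookup A v)) (lookup∘update′ u≢v A (lookup A w))

lookup-swap : ∀ {n} (v w : Fin n) (A : Vec Bool n) u → lookup (swap v w A) u ≡ lookup A (PC.transpose v w u)
lookup-swap v w A u with u ≟ v
lookup-swap v w A u | yes refl with u ≟ w
... | yes refl = lookup-swap-at u u A
... | no u≢w = trans (lookup∘update′ u≢w (A [ u ]≔ lookup A w) (lookup A u)) (lookup∘update u A (lookup A w))
lookup-swap v w A u | no u≢v with u ≟ w
... | yes refl = lookup-swap-at v u A
... | no u≢w = lookup-swap-other v w A u≢v u≢w

insertAt-update : ∀ {n} (A : Vec Bool n) j (b c : Bool) → insertAt A j c [ j ]≔ b ≡ insertAt A j b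
insertAt-update A zero b c = refl
insertAt-update (x ∷ A) (suc j) b c = cong (x ∷_) (insertAt-update A j b c)

-- Splitting off the coordinates 0 and suc w, the swap exchanges the two summands in which they differ.
∑ₛ-swap : ∀ n (v w : Fin n) (F : Vec Bool n → ℕ) → ∑ₛ n (F ∘ swap v w) ≡ ∑ₛ n F
∑ₛ-swap (suc n) zero zero F = refl
∑ₛ-swap (suc n) (suc v) (suc w) F = cong₂ _+_ (∑ₛ-swap n v w (F ∘ (true ∷_))) (∑ₛ-swap n v w (F ∘ (false ∷_)))
∑ₛ-swap (suc (suc n)) zero (suc w) F = begin
  ∑ₛ (suc (suc n)) (F ∘ swap zero (suc w))
    ≡⟨ cong₂ _+_ (∑ₛ-insertAt n w (λ A → F (swap zero (suc w) (true ∷ A)))) (∑ₛ-insertAt n w (λ A → F (swap zero (suc w) (false ∷ A)))) ⟩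
  (U′ true true + U′ true false) + (U′ false true + U′ false false)
    ≡⟨ cong₂ _+_ (cong₂ _+_ (U′≡U true true) (U′≡U true false)) (cong₂ _+_ (U′≡U false true) (U′≡U false false)) ⟩
  (U true true + U false true) + (U true false + U false false)
    ≡⟨ interchange (U true true) (U false true) (U true false) (U false false) ⟩
  (U true true + U true false) + (U false true + U false false)
    ≡⟨ sym (cong₂ _+_ (∑ₛ-insertAt n w (F ∘ (true ∷_))) (∑ₛ-insertAt n w (F ∘ (false ∷_)))) ⟩
  ∑ₛ (suc (suc n)) F ∎
  where
  open ≡-Reasoning
  U U′ : Bool → Bool → ℕ
  U b c = ∑ₛ n (λ A → F (b ∷ insertAt A w c))
  U′ b c = ∑ₛ n (λ A → F (swap zero (suc w) (b ∷ insertAt A w c)))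
  U′≡U : ∀ b c → U′ b c ≡ U c b
  U′≡U b c = ∑ₛ-cong n (λ A → cong F (cong₂ _∷_ (insertAt-lookup A w c) (insertAt-update A w b c)))
∑ₛ-swap (suc (suc n)) (suc v) zero F =
  trans (∑ₛ-cong _ (λ A → cong F (swap-comm (suc v) zero A))) (∑ₛ-swap _ zero (suc v) F)

-- Subsets, lists and cardinalities

sum-map-tabulate : ∀ {A : Set} (f : A → ℕ) {n} (g : Fin n → A) → sum (map f (tabulate g)) ≡ ∑ (f ∘ g)
sum-map-tabulate f {zero} g = refl
sum-map-tabulate f {suc n} g = cong (_+_ (f (g zero))) (sum-map-tabulate f (g ∘ suc))

∑-allSubsets : ∀ n (F : Subset n → ℕ) → sum (map F (allSubsets n)) ≡ ∑ₛ n F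
∑-allSubsets zero F = +-identityʳ (F [])
∑-allSubsets (suc n) F = begin
  sum (map F (map (true ∷_) Aₙ ++ map (false ∷_) Aₙ))
    ≡⟨ cong sum (map-++ F (map (true ∷_) Aₙ) _) ⟩
  sum (map F (map (true ∷_) Aₙ) ++ map F (map (false ∷_) Aₙ))
    ≡⟨ sum-++ (map F (map (true ∷_) Aₙ)) _ ⟩
  sum (map F (map (true ∷_) Aₙ)) + sum (map F (map (false ∷_) Aₙ))
    ≡⟨ cong₂ _+_ (cong sum (sym (map-∘ Aₙ))) (cong sum (sym (map-∘ Aₙ))) ⟩
  sum (map (F ∘ (true ∷_)) Aₙ) + sum (map (F ∘ (false ∷_)) Aₙ)
    ≡⟨ cong₂ _+_ (∑-allSubsets n _) (∑-allSubsets n _) ⟩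
  ∑ₛ (suc n) F ∎
  where
  open ≡-Reasoning
  Aₙ = allSubsets n

length-filterᵇ : ∀ {A : Set} (p : A → Bool) xs → length (filterᵇ p xs) ≡ sum (map (⟦_⟧ ∘ p) xs)
length-filterᵇ p [] = refl
length-filterᵇ p (x ∷ xs) with p x
... | true = cong suc (length-filterᵇ p xs)
... | false = length-filterᵇ p xs

∈-allSubsets : ∀ {n} (A : Subset n) → A ∈ᴸ allSubsets n
∈-allSubsets [] = here refl
∈-allSubsets (true ∷ A) = ∈-++⁺ˡ (∈-map⁺ (true ∷_) (∈-allSubsets A))
∈-allSubsets {suc n} (false ∷ A) = ∈-++⁺ʳ (map (true ∷_) (allSubsets n)) (∈-map⁺ (false ∷_) (∈-allSubsets A))

∣∣≡∑ : ∀ {n} (A : Subset n) → ∣ A ∣ ≡ ∑ (λ u → ⟦ lookup A u ⟧)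
∣∣≡∑ [] = refl
∣∣≡∑ (true ∷ A) = cong suc (∣∣≡∑ A)
∣∣≡∑ (false ∷ A) = ∣∣≡∑ A

∑ₛ-∣∣≡ : ∀ n s → ∑ₛ n (λ A → ⟦ ∣ A ∣ ≡ᵇ s ⟧) ≡ n C s
∑ₛ-∣∣≡ zero zero = refl
∑ₛ-∣∣≡ zero (suc s) = refl
∑ₛ-∣∣≡ (suc n) zero = cong₂ _+_ (∑ₛ-zero n) (∑ₛ-∣∣≡ n zero)
∑ₛ-∣∣≡ (suc n) (suc s) = trans (cong₂ _+_ (∑ₛ-∣∣≡ n s) (∑ₛ-∣∣≡ n (suc s))) (nCk+nC[k+1]≡[n+1]C[k+1] n s)

∈⇒T : ∀ {n} {p : Subset n} {x} → x ∈ p → T (lookup p x)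
∈⇒T x∈p = Equivalence.from T-≡ ([]=⇒lookup x∈p)

T⇒∈ : ∀ {n} {p : Subset n} {x} → T (lookup p x) → x ∈ p
T⇒∈ {p = p} {x} px = lookup⇒[]= x p (Equivalence.to T-≡ px)

⊆⇒T⊆ᵇ : ∀ {n} {p q : Subset n} → p ⊆ q → T (p ⊆ᵇ q)
⊆⇒T⊆ᵇ {p = []} {[]} _ = tt
⊆⇒T⊆ᵇ {p = outside ∷ p} {_ ∷ q} p⊆q = ⊆⇒T⊆ᵇ (drop-∷-⊆ p⊆q)
⊆⇒T⊆ᵇ {p = inside ∷ p} {_ ∷ q} p⊆q with p⊆q here
... | here = ⊆⇒T⊆ᵇ (drop-∷-⊆ p⊆q)

⊆-between : ∀ {n} {M X : Subset n} k → M ⊆ X → ∣ M ∣ ≤ k → k ≤ ∣ X ∣ → ∃ λ e → M ⊆ e × e ⊆ X × ∣ e ∣ ≡ k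
⊆-between {M = []} {[]} zero _ _ _ = [] , ⊆-refl , ⊆-refl , refl
⊆-between {M = outside ∷ M} {outside ∷ X} k M⊆X M≤k k≤X with ⊆-between k (drop-∷-⊆ M⊆X) M≤k k≤X
... | e , M⊆e , e⊆X , ∣e∣≡k = outside ∷ e , out⊆ M⊆e , out⊆ e⊆X , ∣e∣≡k
⊆-between {M = inside ∷ M} {outside ∷ X} k M⊆X M≤k k≤X with M⊆X here
... | ()
⊆-between {M = inside ∷ M} {inside ∷ X} (suc k) M⊆X M≤k k≤X with ⊆-between k (drop-∷-⊆ M⊆X) (s≤s⁻¹ M≤k) (s≤s⁻¹ k≤X)
... | e , M⊆e , e⊆X , ∣e∣≡k = inside ∷ e , in⊆in M⊆e , in⊆in e⊆X , cong suc ∣e∣≡k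
⊆-between {M = outside ∷ M} {inside ∷ X} k M⊆X M≤k k≤X with k ≤? ∣ X ∣
... | yes k≤∣X∣ with ⊆-between k (drop-∷-⊆ M⊆X) M≤k k≤∣X∣
...   | e , M⊆e , e⊆X , ∣e∣≡k = outside ∷ e , out⊆ M⊆e , out⊆ e⊆X , ∣e∣≡k
⊆-between {M = outside ∷ M} {inside ∷ X} k M⊆X M≤k k≤X | no k≰∣X∣ =
  inside ∷ X , M⊆X , ⊆-refl , ≤-antisym (≰⇒> k≰∣X∣) k≤X

-- Elementary inequalities

bernoulli : ∀ x k → x ^ k * (x + k) ≤ x * suc x ^ k
bernoulli x zero = ≤-reflexive (trans (*-identityˡ (x + 0)) (trans (+-identityʳ x) (sym (*-identityʳ x))))
bernoulli x (suc k) = begin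
  x ^ suc k * (x + suc k)    ≡⟨ x*y*z≡y*[x*z] x (x ^ k) _ ⟩
  x ^ k * (x * (x + suc k))  ≤⟨ *-monoʳ-≤ (x ^ k) (m+n≤o⇒m≤o _ (≤-reflexive (x*[x+1+k]+k≡[1+x]*[x+k] x k))) ⟩
  x ^ k * (suc x * (x + k))  ≡⟨ x*[y*z]≡y*[x*z] (x ^ k) (suc x) _ ⟩
  suc x * (x ^ k * (x + k))  ≤⟨ *-monoʳ-≤ (suc x) (bernoulli x k) ⟩
  suc x * (x * suc x ^ k)    ≡⟨ x*[y*z]≡y*[x*z] (suc x) x _ ⟩
  x * suc x ^ suc k          ∎
  where
  open ≤-Reasoning
  x*[x+1+k]+k≡[1+x]*[x+k] : ∀ x k → x * (x + suc k) + k ≡ suc x * (x + k)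
  x*[x+1+k]+k≡[1+x]*[x+k] = solve-∀

2*n^n≤[1+n]^n : ∀ n → .{{NonZero n}} → 2 * n ^ n ≤ suc n ^ n
2*n^n≤[1+n]^n n = *-cancelˡ-≤ n (begin
  n * (2 * n ^ n) ≡⟨ x*[2*y]≡y*[x+x] n (n ^ n) ⟩
  n ^ n * (n + n) ≤⟨ bernoulli n n ⟩
  n * suc n ^ n   ∎)
  where
  open ≤-Reasoning
  x*[2*y]≡y*[x+x] : ∀ x y → x * (2 * y) ≡ y * (x + x)
  x*[2*y]≡y*[x+x] = solve-∀

3*n^2q≤[1+n]^2q : ∀ {n q} → 1 ≤ q → n ≤ q → 3 * n ^ (2 * q) ≤ suc n ^ (2 * q)
3*n^2q≤[1+n]^2q {zero} {suc q} _ _ = z≤n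
3*n^2q≤[1+n]^2q {n@(suc _)} {q} _ n≤q = begin
  3 * n ^ (2 * q)                   ≤⟨ *-monoˡ-≤ (n ^ (2 * q)) (n≤1+n 3) ⟩
  4 * n ^ (2 * q)                   ≡⟨ cong (λ e → 4 * n ^ e) 2q≡n+n+t ⟩
  4 * n ^ (n + n + t)               ≡⟨ cong (4 *_) (^-split n) ⟩
  4 * (n ^ n * n ^ n * n ^ t)       ≡⟨ 4*[x*x*y]≡2*x*[2*x]*y (n ^ n) (n ^ t) ⟩
  2 * n ^ n * (2 * n ^ n) * n ^ t   ≤⟨ *-mono-≤ (*-mono-≤ (2*n^n≤[1+n]^n n) (2*n^n≤[1+n]^n n)) (^-monoˡ-≤ t (n≤1+n n)) ⟩
  suc n ^ n * suc n ^ n * suc n ^ t ≡⟨ ^-split (suc n) ⟨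
  suc n ^ (n + n + t)               ≡⟨ cong (suc n ^_) 2q≡n+n+t ⟨
  suc n ^ (2 * q)                   ∎
  where
  open ≤-Reasoning
  t = 2 * q ∸ (n + n)
  2q≡n+n+t : 2 * q ≡ n + n + t
  2q≡n+n+t = sym (m+[n∸m]≡n (subst (n + n ≤_) (cong (_+_ q) (sym (+-identityʳ q))) (+-mono-≤ n≤q n≤q)))
  ^-split : ∀ b → b ^ (n + n + t) ≡ b ^ n * b ^ n * b ^ t
  ^-split b = trans (^-distribˡ-+-* b (n + n) t) (cong (_* b ^ t) (^-distribˡ-+-* b n n))
  4*[x*x*y]≡2*x*[2*x]*y : ∀ x y → 4 * (x * x * y) ≡ 2 * x * (2 * x) * y
  4*[x*x*y]≡2*x*[2*x]*y = solve-∀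

n^2q*3^a≤[n+a]^2q : ∀ {q} → 1 ≤ q → ∀ n a → n + a ≤ suc q → n ^ (2 * q) * 3 ^ a ≤ (n + a) ^ (2 * q)
n^2q*3^a≤[n+a]^2q {q} _ n zero _ = ≤-reflexive (trans (*-identityʳ _) (cong (_^ (2 * q)) (sym (+-identityʳ n))))
n^2q*3^a≤[n+a]^2q {q} 1≤q n (suc a) n+1+a≤1+q = begin
  n ^ (2 * q) * (3 * 3 ^ a)
    ≡⟨ *-assoc (n ^ (2 * q)) 3 (3 ^ a) ⟨
  n ^ (2 * q) * 3 * 3 ^ a
    ≤⟨ *-monoˡ-≤ (3 ^ a) (≤-trans (≤-reflexive (*-comm (n ^ (2 * q)) 3)) (3*n^2q≤[1+n]^2q 1≤q n≤q)) ⟩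
  suc n ^ (2 * q) * 3 ^ a
    ≤⟨ n^2q*3^a≤[n+a]^2q 1≤q (suc n) a 1+n+a≤1+q ⟩
  (suc n + a) ^ (2 * q)
    ≡⟨ cong (_^ (2 * q)) (+-suc n a) ⟨
  (n + suc a) ^ (2 * q) ∎
  where
  open ≤-Reasoning
  1+n+a≤1+q : suc n + a ≤ suc q
  1+n+a≤1+q = subst (_≤ suc q) (+-suc n a) n+1+a≤1+q
  n≤q : n ≤ q
  n≤q = s≤s⁻¹ (m+n≤o⇒m≤o (suc n) 1+n+a≤1+q)

[n∸L]^2q*3^a≤n^2q*3^r : ∀ {q a n} r → 1 ≤ q → a ≤ n → n ≤ suc q →
  (n ∸ (if r ≤ᵇ a then a else 0)) ^ (2 * q) * 3 ^ a ≤ n ^ (2 * q) * 3 ^ r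
[n∸L]^2q*3^a≤n^2q*3^r {q} {a} {n} r 1≤q a≤n n≤1+q with r ≤ᵇ a in r≤ᵇa
... | true = begin
  (n ∸ a) ^ (2 * q) * 3 ^ a  ≤⟨ n^2q*3^a≤[n+a]^2q 1≤q (n ∸ a) a (≤-trans (≤-reflexive n∸a+a≡n) n≤1+q) ⟩
  (n ∸ a + a) ^ (2 * q)      ≡⟨ cong (_^ (2 * q)) n∸a+a≡n ⟩
  n ^ (2 * q)                ≤⟨ m≤m*n (n ^ (2 * q)) (3 ^ r) {{m^n≢0 3 r}} ⟩
  n ^ (2 * q) * 3 ^ r        ∎
  where
  open ≤-Reasoning
  n∸a+a≡n : n ∸ a + a ≡ n
  n∸a+a≡n = m∸n+n≡m a≤n
... | false = *-monoʳ-≤ (n ^ (2 * q)) (^-monoʳ-≤ 3 (≰⇒≥ {r} {a} (λ r≤a → subst T r≤ᵇa (≤⇒≤ᵇ r≤a))))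

^*≤^-pow : ∀ {x y c} p k → x ^ p * c ≤ y ^ p → x ^ (p * k) * c ^ k ≤ y ^ (p * k)
^*≤^-pow {x} {y} {c} p k h = begin
  x ^ (p * k) * c ^ k     ≡⟨ cong (_* c ^ k) (^-*-assoc x p k) ⟨
  (x ^ p) ^ k * c ^ k     ≡⟨ ^-distribʳ-* (x ^ p) c k ⟨
  (x ^ p * c) ^ k         ≤⟨ ^-monoˡ-≤ k h ⟩
  (y ^ p) ^ k             ≡⟨ ^-*-assoc y p k ⟩
  y ^ (p * k)             ∎
  where open ≤-Reasoning

^*≤^-raise : ∀ {x y c p p′} → x ≤ y → p ≤ p′ → x ^ p * c ≤ y ^ p → x ^ p′ * c ≤ y ^ p′
^*≤^-raise {x} {y} {c} {p} {p′} x≤y p≤p′ h = begin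
  x ^ p′ * c              ≡⟨ cong (λ e → x ^ e * c) p′≡p+e ⟩
  x ^ (p + e) * c         ≡⟨ cong (_* c) (^-distribˡ-+-* x p e) ⟩
  x ^ p * x ^ e * c       ≡⟨ x*y*z≡x*z*y (x ^ p) (x ^ e) c ⟩
  x ^ p * c * x ^ e       ≤⟨ *-mono-≤ h (^-monoˡ-≤ e x≤y) ⟩
  y ^ p * y ^ e           ≡⟨ ^-distribˡ-+-* y p e ⟨
  y ^ (p + e)             ≡⟨ cong (y ^_) p′≡p+e ⟨
  y ^ p′                  ∎
  where
  open ≤-Reasoning
  e = p′ ∸ p
  p′≡p+e : p′ ≡ p + e
  p′≡p+e = sym (m+[n∸m]≡n p≤p′)

-- If x/y ≤ x′/y′ then (x + x′)/(y + y′) ≤ x′/y′, so the bound for x′, y′ carries over.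
mediant-^*≤^ : ∀ n {c} → 1 ≤ c → ∀ {x y x′ y′} → x ^ n * c ≤ y ^ n → x′ ^ n * c ≤ y′ ^ n →
  x * y′ ≤ x′ * y → (x + x′) ^ n * c ≤ (y + y′) ^ n
mediant-^*≤^ zero _ h _ _ = h
mediant-^*≤^ (suc n) {c} 1≤c {x} {y} {x′} {zero} h h′ _
  rewrite m^n≡0⇒m≡0 x′ (suc n) (n≤0⇒n≡0 (≤-trans (m≤m*n (x′ ^ suc n) c {{>-nonZero 1≤c}}) h′))
        | +-identityʳ x | +-identityʳ y = h
mediant-^*≤^ n {c} _ {x} {y} {x′} {y′@(suc _)} _ h′ xy′≤x′y = *-cancelʳ-≤ _ _ (y′ ^ n) {{m^n≢0 y′ n}} (begin
  (x + x′) ^ n * c * y′ ^ n     ≡⟨ x*y*z≡x*z*y ((x + x′) ^ n) c (y′ ^ n) ⟩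
  (x + x′) ^ n * y′ ^ n * c     ≡⟨ cong (_* c) (^-distribʳ-* (x + x′) y′ n) ⟨
  ((x + x′) * y′) ^ n * c       ≤⟨ *-monoˡ-≤ c (^-monoˡ-≤ n [x+x′]y′≤x′[y+y′]) ⟩
  (x′ * (y + y′)) ^ n * c       ≡⟨ cong (_* c) (^-distribʳ-* x′ (y + y′) n) ⟩
  x′ ^ n * (y + y′) ^ n * c     ≡⟨ x*y*z≡x*z*y (x′ ^ n) ((y + y′) ^ n) c ⟩
  x′ ^ n * c * (y + y′) ^ n     ≤⟨ *-monoˡ-≤ ((y + y′) ^ n) h′ ⟩
  y′ ^ n * (y + y′) ^ n         ≡⟨ *-comm (y′ ^ n) _ ⟩
  (y + y′) ^ n * y′ ^ n         ∎)
  where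
  open ≤-Reasoning
  [x+x′]y′≤x′[y+y′] : (x + x′) * y′ ≤ x′ * (y + y′)
  [x+x′]y′≤x′[y+y′] = begin
    (x + x′) * y′     ≡⟨ *-distribʳ-+ y′ x x′ ⟩
    x * y′ + x′ * y′  ≤⟨ +-monoˡ-≤ (x′ * y′) xy′≤x′y ⟩
    x′ * y + x′ * y′  ≡⟨ *-distribˡ-+ x′ y y′ ⟨
    x′ * (y + y′)     ∎

+-preserves-^*≤^ : ∀ n {c} → 1 ≤ c → ∀ {x y x′ y′} → x ^ n * c ≤ y ^ n → x′ ^ n * c ≤ y′ ^ n →
  (x + x′) ^ n * c ≤ (y + y′) ^ n
+-preserves-^*≤^ n {c} 1≤c {x} {y} {x′} {y′} h h′ with ≤-total (x * y′) (x′ * y)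
... | inj₁ xy′≤x′y = mediant-^*≤^ n 1≤c h h′ xy′≤x′y
... | inj₂ x′y≤xy′ = subst₂ (λ a b → a ^ n * c ≤ b ^ n) (+-comm x′ x) (+-comm y′ y) (mediant-^*≤^ n 1≤c h′ h x′y≤xy′)

∑ₛ-preserves-^*≤^ : ∀ n p {c} → 1 ≤ c → {F G : Vec Bool n → ℕ} → (∀ A → F A ^ p * c ≤ G A ^ p) →
  ∑ₛ n F ^ p * c ≤ ∑ₛ n G ^ p
∑ₛ-preserves-^*≤^ zero p 1≤c h = h []
∑ₛ-preserves-^*≤^ (suc n) p 1≤c h =
  +-preserves-^*≤^ p 1≤c (∑ₛ-preserves-^*≤^ n p 1≤c (h ∘ (true ∷_))) (∑ₛ-preserves-^*≤^ n p 1≤c (h ∘ (false ∷_)))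

⟦⟧*-^*≤^ : ∀ b {x y c p} → 1 ≤ p → (T b → x ^ p * c ≤ y ^ p) → (⟦ b ⟧ * x) ^ p * c ≤ (⟦ b ⟧ * y) ^ p
⟦⟧*-^*≤^ false {p = suc p} _ _ = z≤n
⟦⟧*-^*≤^ true {x} {y} {c} {p} _ h = subst₂ (λ a b → a ^ p * c ≤ b ^ p) (sym (*-identityˡ x)) (sym (*-identityˡ y)) (h tt)

⌈/⌉≤1+/ : ∀ d m .{{_ : NonZero m}} → ⌈ d / m ⌉ ≤ suc (d / m)
⌈/⌉≤1+/ d m = begin
  (d + (m ∸ 1)) / m       ≤⟨ /-monoˡ-≤ m (+-monoʳ-≤ d (m∸n≤m m 1)) ⟩
  (d + m) / m             ≡⟨ m/n≡1+[m∸n]/n (m≤n+m m d) ⟩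
  suc ((d + m ∸ m) / m)   ≡⟨ cong (λ x → suc (x / m)) (m+n∸n≡m d m) ⟩
  suc (d / m)             ∎
  where open ≤-Reasoning

-- Comparison with powers of e

sum-map-applyUpTo : ∀ (f : ℕ → ℕ) g n → sum (map f (applyUpTo g n)) ≡ ∑ {n} (f ∘ g ∘ toℕ)
sum-map-applyUpTo f g zero = refl
sum-map-applyUpTo f g (suc n) = cong (_+_ (f (g 0))) (sum-map-applyUpTo f (g ∘ suc) n)

[1+n]P[1+k]≡[1+n]*nPk : ∀ {n k} → k ≤ n → suc n P suc k ≡ suc n * (n P k)
[1+n]P[1+k]≡[1+n]*nPk {n} {k} k≤n
  rewrite Equivalence.to T-≡ (≤⇒≤ᵇ k≤n) | Equivalence.to T-≡ (≤⇒≤ᵇ (s≤s k≤n)) = P′-suc k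
  where
  P′-suc : ∀ k → suc n P′ suc k ≡ suc n * (n P′ k)
  P′-suc zero = refl
  P′-suc (suc k) = trans (cong ((n ∸ k) *_) (P′-suc k)) (x*[y*z]≡y*[x*z] (n ∸ k) (suc n) (n P′ k))

eNum≡∑ : ∀ N → eNum N ≡ ∑ {suc N} (λ j → N P (N ∸ toℕ j))
eNum≡∑ N = sum-map-applyUpTo (λ j → N P (N ∸ j)) (λ j → j) (suc N)

eNum-suc : ∀ N → eNum (suc N) ≡ suc N * eNum N + 1
eNum-suc N = begin
  eNum (suc N)                                  ≡⟨ eNum≡∑ (suc N) ⟩
  ∑ {suc (suc N)} F                             ≡⟨ sum-init-last F ⟩
  ∑ {suc N} (F ∘ inject₁) + F (fromℕ (suc N))   ≡⟨ cong₂ _+_ (sum-cong-≗ init-term) last-term ⟩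
  ∑ {suc N} (λ j → suc N * (N P (N ∸ toℕ j))) + 1 ≡⟨ cong (_+ 1) (*-distribˡ-sum {suc N} (suc N) (λ j → N P (N ∸ toℕ j))) ⟨
  suc N * ∑ {suc N} (λ j → N P (N ∸ toℕ j)) + 1   ≡⟨ cong (λ e → suc N * e + 1) (eNum≡∑ N) ⟨
  suc N * eNum N + 1                            ∎
  where
  open ≡-Reasoning
  F : Fin (suc (suc N)) → ℕ
  F j = suc N P (suc N ∸ toℕ j)
  last-term : F (fromℕ (suc N)) ≡ 1
  last-term rewrite toℕ-fromℕ N | n∸n≡0 N = refl
  init-term : ∀ j → F (inject₁ j) ≡ suc N * (N P (N ∸ toℕ j))
  init-term j rewrite toℕ-inject₁ j | +-∸-assoc 1 (toℕ≤pred[n] j) = [1+n]P[1+k]≡[1+n]*nPk (m∸n≤m N (toℕ j))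

eNum≤3*N! : ∀ N → eNum N ≤ 3 * N !
eNum≤3*N! zero = s≤s z≤n
eNum≤3*N! (suc N) = m+n≤o⇒m≤o _ (eNum+1≤3*N! (suc N))
  where
  eNum+1≤3*N! : ∀ N → .{{NonZero N}} → eNum N + 1 ≤ 3 * N !
  eNum+1≤3*N! 1 = ≤-refl
  eNum+1≤3*N! (suc N@(suc _)) = begin
    eNum (suc N) + 1               ≡⟨ cong (_+ 1) (eNum-suc N) ⟩
    suc N * eNum N + 1 + 1         ≤⟨ +-monoʳ-≤ (suc N * eNum N + 1) (s≤s z≤n) ⟩
    suc N * eNum N + 1 + N         ≡⟨ x*y+1+x≡[1+x]*[y+1] N (eNum N) ⟩
    suc N * (eNum N + 1)           ≤⟨ *-monoʳ-≤ (suc N) (eNum+1≤3*N! N) ⟩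
    suc N * (3 * N !)              ≡⟨ x*[y*z]≡y*[x*z] (suc N) 3 (N !) ⟩
    3 * suc N !                    ∎
    where
    open ≤-Reasoning
    x*y+1+x≡[1+x]*[y+1] : ∀ x y → suc x * y + 1 + x ≡ suc x * (y + 1)
    x*y+1+x≡[1+x]*[y+1] = solve-∀

LeExp-+ : ∀ {a b} k → a ≤ b → LeExp a b (+ k)
LeExp-+ k a≤b = 0 , *-monoˡ-≤ (1 ^ k) a≤b

LeExp-- : ∀ {a b} K → a * 3 ^ K ≤ b → LeExp a b (- (+ K))
LeExp-- {a} {b} zero a*1≤b = LeExp-+ 0 (subst (_≤ b) (*-identityʳ a) a*1≤b)
LeExp-- {a} {b} K@(suc _) a*3^K≤b N = begin
  a * eNum N ^ K          ≤⟨ *-monoʳ-≤ a (^-monoˡ-≤ K (eNum≤3*N! N)) ⟩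
  a * (3 * N !) ^ K       ≡⟨ cong (a *_) (^-distribʳ-* 3 (N !) K) ⟩
  a * (3 ^ K * (N !) ^ K)   ≡⟨ *-assoc a (3 ^ K) ((N !) ^ K) ⟨
  a * 3 ^ K * (N !) ^ K     ≤⟨ *-monoˡ-≤ ((N !) ^ K) a*3^K≤b ⟩
  b * (N !) ^ K             ∎
  where open ≤-Reasoning

-[m*[s-t]]≡+[m*[t∸s]] : ∀ m {s t} → s ≤ t → - (+ m *ℤ (+ s -ℤ + t)) ≡ + (m * (t ∸ s))
-[m*[s-t]]≡+[m*[t∸s]] m {s} {t} s≤t = begin
  - (+ m *ℤ (+ s -ℤ + t))     ≡⟨ cong (λ z → - (+ m *ℤ z)) (trans (ℤ.[+m]-[+n]≡m⊖n s t) (ℤ.⊖-≤ s≤t)) ⟩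
  - (+ m *ℤ - + (t ∸ s))      ≡⟨ cong -_ (ℤ.neg-distribʳ-* (+ m) (+ (t ∸ s))) ⟨
  - - (+ m *ℤ + (t ∸ s))      ≡⟨ ℤ.neg-involutive _ ⟩
  + m *ℤ + (t ∸ s)            ≡⟨ ℤ.pos-* m (t ∸ s) ⟨
  + (m * (t ∸ s))             ∎
  where open ≡-Reasoning

-[m*[s-t]]≡-[m*[s∸t]] : ∀ m {s t} → t ≤ s → - (+ m *ℤ (+ s -ℤ + t)) ≡ - + (m * (s ∸ t))
-[m*[s-t]]≡-[m*[s∸t]] m {s} {t} t≤s =
  trans (cong (λ z → - (+ m *ℤ z)) (trans (ℤ.[+m]-[+n]≡m⊖n s t) (ℤ.⊖-≥ t≤s))) (cong -_ (sym (ℤ.pos-* m (s ∸ t))))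

-- Disjoint stars

module Stars {d m : ℕ} (r : ℕ) (part : Fin d → Fin m) (centre : Fin m → Fin d)
             (part∘centre : ∀ i → part (centre i) ≡ i) where

  edgeᵇ : Subset d → Bool
  edgeᵇ = starsEdgeᵇ r part centre

  ∣V_∣ : Fin m → ℕ
  ∣V i ∣ = ∑ (λ u → ⟦ δ (part u) i ⟧)

  ∣_∩V_∣ : Subset d → Fin m → ℕ
  ∣ A ∩V i ∣ = ∑ (λ u → ⟦ δ (part u) i ∧ lookup A u ⟧)

  big : Fin m → Subset d → Bool
  big i A = r ≤ᵇ ∣ A ∩V i ∣

  starFree : Fin m → Subset d → Bool
  starFree i A = not (lookup A (centre i) ∧ big i A)

  -- avgWeight i A is the average of freeWeight i A over the |Vᵢ| possible positions of the centre in Vᵢ.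
  freeWeight avgWeight : Fin m → Subset d → ℕ
  freeWeight i A = ∣V i ∣ * ⟦ starFree i A ⟧
  avgWeight i A = ∣V i ∣ ∸ (if big i A then ∣ A ∩V i ∣ else 0)

  δ-centre : ∀ i → δ (part (centre i)) i ≡ true
  δ-centre i = trans (cong (λ j → δ j i) (part∘centre i)) (δ-refl i)

  classSize≡∣V∣ : ∀ i → classSize part i ≡ ∣V i ∣
  classSize≡∣V∣ i = trans (length-filterᵇ _ (allFin d)) (sum-map-tabulate (λ v → ⟦ δ (part v) i ⟧) (λ v → v))

  ∣∩V∣≤∣V∣ : ∀ A i → ∣ A ∩V i ∣ ≤ ∣V i ∣
  ∣∩V∣≤∣V∣ A i = ∑-mono (λ u → ⟦∧⟧≤ˡ (δ (part u) i) (lookup A u))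

  SwapInvariant : Fin m → (Subset d → ℕ) → Set
  SwapInvariant k G = ∀ v A → part v ≡ k → G (swap v (centre k) A) ≡ G A

  module _ {k : Fin m} {v : Fin d} (part-v : part v ≡ k) where

    private
      c = centre k

    ∑-swap : ∀ (h : Fin m → Bool → ℕ) A → ∑ (λ u → h (part u) (lookup (swap v c A) u)) ≡ ∑ (λ u → h (part u) (lookup A u))
    ∑-swap h A = begin
      ∑ (λ u → h (part u) (lookup (swap v c A) u))
        ≡⟨ sum-cong-≗ (λ u → cong₂ h (sym (part∘τ u)) (lookup-swap v c A u)) ⟩
      ∑ (λ u → h (part (τ u)) (lookup A (τ u)))
        ≡⟨ sum-permute (λ u → h (part u) (lookup A u)) (transpose v c) ⟨
      ∑ (λ u → h (part u) (lookup A u)) ∎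
      where
      open ≡-Reasoning
      τ = PC.transpose v c
      part∘τ : ∀ u → part (τ u) ≡ part u
      part∘τ u with u ≟ v
      ... | yes refl = trans (part∘centre k) (sym part-v)
      ... | no _ with u ≟ c
      ...   | yes refl = trans part-v (sym (part∘centre k))
      ...   | no _ = refl

    ∣swap∣ : ∀ A → ∣ swap v c A ∣ ≡ ∣ A ∣
    ∣swap∣ A = trans (∣∣≡∑ (swap v c A)) (trans (∑-swap (λ _ b → ⟦ b ⟧) A) (sym (∣∣≡∑ A)))

    ∣swap∩V∣ : ∀ A i → ∣ swap v c A ∩V i ∣ ≡ ∣ A ∩V i ∣
    ∣swap∩V∣ A i = ∑-swap (λ j b → ⟦ δ j i ∧ b ⟧) A

    big-swap : ∀ A i → big i (swap v c A) ≡ big i A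
    big-swap A i = cong (r ≤ᵇ_) (∣swap∩V∣ A i)

    avgWeight-swap : ∀ A i → avgWeight i (swap v c A) ≡ avgWeight i A
    avgWeight-swap A i rewrite big-swap A i | ∣swap∩V∣ A i = refl

    freeWeight-swap : ∀ A {i} → i ≢ k → freeWeight i (swap v c A) ≡ freeWeight i A
    freeWeight-swap A {i} i≢k = cong (λ b → ∣V i ∣ * ⟦ not b ⟧) (cong₂ _∧_ centre-fixed (big-swap A i))
      where
      centre-fixed : lookup (swap v c A) (centre i) ≡ lookup A (centre i)
      centre-fixed = lookup-swap-other v c A
        (λ cᵢ≡v → i≢k (trans (sym (part∘centre i)) (trans (cong part cᵢ≡v) part-v)))
        (λ cᵢ≡c → i≢k (trans (sym (part∘centre i)) (trans (cong part cᵢ≡c) (part∘centre k))))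

  -- Swapping the centre with u ∈ Vₖ permutes the subsets and preserves G, so u is as often in A as the centre.
  centre-symmetry : ∀ k (G : Subset d → ℕ) → SwapInvariant k G →
    ∣V k ∣ * ∑ₛ d (λ A → G A * ⟦ lookup A (centre k) ⟧) ≡ ∑ₛ d (λ A → G A * ∣ A ∩V k ∣)
  centre-symmetry k G inv = begin
    ∣V k ∣ * Sᶜ
      ≡⟨ *-distribʳ-sum Sᶜ (λ u → ⟦ δ (part u) k ⟧) ⟩
    ∑ (λ u → ⟦ δ (part u) k ⟧ * Sᶜ)
      ≡⟨ sum-cong-≗ (λ u → summand u (δ (part u) k) refl) ⟩
    ∑ (λ u → ∑ₛ d (λ A → G A * ⟦ δ (part u) k ∧ lookup A u ⟧))
      ≡⟨ ∑ₛ-∑-comm d (λ u A → G A * ⟦ δ (part u) k ∧ lookup A u ⟧) ⟨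
    ∑ₛ d (λ A → ∑ (λ u → G A * ⟦ δ (part u) k ∧ lookup A u ⟧))
      ≡⟨ ∑ₛ-cong d (λ A → *-distribˡ-sum (G A) (λ u → ⟦ δ (part u) k ∧ lookup A u ⟧)) ⟨
    ∑ₛ d (λ A → G A * ∣ A ∩V k ∣) ∎
    where
    open ≡-Reasoning
    c = centre k
    Sᶜ = ∑ₛ d (λ A → G A * ⟦ lookup A c ⟧)
    summand : ∀ u b → δ (part u) k ≡ b → ⟦ b ⟧ * Sᶜ ≡ ∑ₛ d (λ A → G A * ⟦ b ∧ lookup A u ⟧)
    summand u false _ = sym (trans (∑ₛ-cong d (λ A → *-zeroʳ (G A))) (∑ₛ-zero d))
    summand u true part-u≡k = begin
      1 * Sᶜ
        ≡⟨ *-identityˡ Sᶜ ⟩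
      ∑ₛ d (λ A → G A * ⟦ lookup A c ⟧)
        ≡⟨ ∑ₛ-swap d u c (λ A → G A * ⟦ lookup A c ⟧) ⟨
      ∑ₛ d (λ A → G (swap u c A) * ⟦ lookup (swap u c A) c ⟧)
        ≡⟨ ∑ₛ-cong d (λ A → cong₂ (λ x b → x * ⟦ b ⟧) (inv u A (δ≡true⇒≡ part-u≡k)) (lookup-swap-at u c A)) ⟩
      ∑ₛ d (λ A → G A * ⟦ lookup A u ⟧) ∎

  ∑ₛ-freeWeight≡∑ₛ-avgWeight : ∀ k (G : Subset d → ℕ) → SwapInvariant k G →
    ∑ₛ d (λ A → G A * freeWeight k A) ≡ ∑ₛ d (λ A → G A * avgWeight k A)
  ∑ₛ-freeWeight≡∑ₛ-avgWeight k G inv = +-cancelʳ-≡ (∑ₛ d X) _ _ (begin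
    ∑ₛ d (λ A → G A * freeWeight k A) + ∑ₛ d X
      ≡⟨ ∑ₛ-distrib-+ d _ X ⟨
    ∑ₛ d (λ A → G A * freeWeight k A + X A)
      ≡⟨ ∑ₛ-cong d (λ A → ⟦not-∧⟧-complement (G A) ∣V k ∣ (lookup A c) (big k A)) ⟩
    ∑ₛ d (λ A → G A * ∣V k ∣)
      ≡⟨ ∑ₛ-cong d (λ A → ∸-if-complement (G A) (big k A) (∣∩V∣≤∣V∣ A k)) ⟨
    ∑ₛ d (λ A → G A * avgWeight k A + Y A)
      ≡⟨ ∑ₛ-distrib-+ d _ Y ⟩
    ∑ₛ d (λ A → G A * avgWeight k A) + ∑ₛ d Y
      ≡⟨ cong (_+_ _) X≡Y ⟨
    ∑ₛ d (λ A → G A * avgWeight k A) + ∑ₛ d X ∎)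
    where
    open ≡-Reasoning
    c = centre k
    Gᵇ X Y : Subset d → ℕ
    Gᵇ A = G A * ⟦ big k A ⟧
    X A = ∣V k ∣ * (Gᵇ A * ⟦ lookup A c ⟧)
    Y A = Gᵇ A * ∣ A ∩V k ∣
    Gᵇ-inv : SwapInvariant k Gᵇ
    Gᵇ-inv v A part-v = cong₂ (λ x b → x * ⟦ b ⟧) (inv v A part-v) (big-swap part-v A k)
    X≡Y : ∑ₛ d X ≡ ∑ₛ d Y
    X≡Y = trans (sym (*-distribˡ-∑ₛ d ∣V k ∣ _)) (centre-symmetry k Gᵇ Gᵇ-inv)

  module _ (w : Subset d → ℕ) (w-inv : ∀ k → SwapInvariant k w) where

    private
      mixed : ℕ → Fin m → Subset d → ℕ
      mixed j i = if does (toℕ i <? j) then avgWeight i else freeWeight i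

      H : ℕ → ℕ
      H j = ∑ₛ d (λ A → w A * ∏ (λ i → mixed j i A))

      mixed-swap : ∀ j {i k} → i ≢ k → SwapInvariant k (mixed j i)
      mixed-swap j {i} i≢k v A part-v with does (toℕ i <? j)
      ... | true = avgWeight-swap part-v A i
      ... | false = freeWeight-swap part-v A i≢k

      H-step : ∀ j (k : Fin m) → toℕ k ≡ j → H j ≡ H (suc j)
      H-step j k k≡j = begin
        ∑ₛ d (λ A → w A * ∏ (λ i → mixed j i A))
          ≡⟨ ∑ₛ-cong d (λ A → trans (cong (_*_ (w A)) (∏-except (λ i → mixed j i A) k)) (x*[y*z]≡x*z*y (w A) _ _)) ⟩
        ∑ₛ d (λ A → G j A * mixed j k A)
          ≡⟨ ∑ₛ-cong d (λ A → cong (λ b → G j A * (if b then avgWeight k else freeWeight k) A) k≮j) ⟩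
        ∑ₛ d (λ A → G j A * freeWeight k A)
          ≡⟨ ∑ₛ-freeWeight≡∑ₛ-avgWeight k (G j) G-swap ⟩
        ∑ₛ d (λ A → G j A * avgWeight k A)
          ≡⟨ ∑ₛ-cong d (λ A → cong₂ (λ g b → g * (if b then avgWeight k else freeWeight k) A) (Gⱼ≡Gⱼ₊₁ A) (sym k<1+j)) ⟩
        ∑ₛ d (λ A → G (suc j) A * mixed (suc j) k A)
          ≡⟨ ∑ₛ-cong d (λ A → trans (cong (_*_ (w A)) (∏-except (λ i → mixed (suc j) i A) k)) (x*[y*z]≡x*z*y (w A) _ _)) ⟨
        ∑ₛ d (λ A → w A * ∏ (λ i → mixed (suc j) i A)) ∎
        where
        open ≡-Reasoning
        G : ℕ → Subset d → ℕ
        G j A = w A * ∏ (λ i → if δ i k then 1 else mixed j i A)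
        k≮j : does (toℕ k <? j) ≡ false
        k≮j = dec-false (toℕ k <? j) (<-irrefl k≡j)
        k<1+j : does (toℕ k <? suc j) ≡ true
        k<1+j = dec-true (toℕ k <? suc j) (s≤s (≤-reflexive k≡j))
        mixed-suc : ∀ i → i ≢ k → mixed (suc j) i ≡ mixed j i
        mixed-suc i i≢k = cong (λ b → if b then avgWeight i else freeWeight i)
          (does-⇔ (mk⇔ (λ i<1+j → ≤∧≢⇒< (s≤s⁻¹ i<1+j) (λ i≡j → i≢k (Finₚ.toℕ-injective (trans i≡j (sym k≡j)))))
                        m<n⇒m<1+n)
                  (toℕ i <? suc j) (toℕ i <? j))
        Gⱼ≡Gⱼ₊₁ : ∀ A → G j A ≡ G (suc j) A
        Gⱼ≡Gⱼ₊₁ A = cong (_*_ (w A)) (∏-cong (λ i → off-k i (δ i k) refl))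
          where
          off-k : ∀ i b → δ i k ≡ b → (if b then 1 else mixed j i A) ≡ (if b then 1 else mixed (suc j) i A)
          off-k i true _ = refl
          off-k i false i≢ᵇk = cong (λ f → f A) (sym (mixed-suc i (δ≡false⇒≢ i≢ᵇk)))
        G-swap : SwapInvariant k (G j)
        G-swap v A part-v = cong₂ _*_ (w-inv k v A part-v) (∏-cong (λ i → off-k i (δ i k) refl))
          where
          off-k : ∀ i b → δ i k ≡ b → (if b then 1 else mixed j i (swap v (centre k) A)) ≡ (if b then 1 else mixed j i A)
          off-k i true _ = refl
          off-k i false i≢ᵇk = mixed-swap j (δ≡false⇒≢ i≢ᵇk) v A part-v

      H0≡Hj : ∀ j → j ≤ m → H 0 ≡ H j
      H0≡Hj zero _ = refl
      H0≡Hj (suc j) j<m = trans (H0≡Hj j (<⇒≤ j<m)) (H-step j (fromℕ< j<m) (toℕ-fromℕ< j<m))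

    ∑ₛ-∏freeWeight≡∑ₛ-∏avgWeight : ∑ₛ d (λ A → w A * ∏ (λ i → freeWeight i A)) ≡ ∑ₛ d (λ A → w A * ∏ (λ i → avgWeight i A))
    ∑ₛ-∏freeWeight≡∑ₛ-∏avgWeight = trans (H0≡Hj m ≤-refl)
      (∑ₛ-cong d (λ A → cong (_*_ (w A)) (∏-cong (λ i → cong (λ b → (if b then avgWeight i else freeWeight i) A) (dec-true (toℕ i <? m) (toℕ<n i))))))

  classPart : Fin m → Subset d → Subset d
  classPart i A = Vec.tabulate (λ u → δ (part u) i ∧ lookup A u)

  lookup-classPart : ∀ i A u → lookup (classPart i A) u ≡ (δ (part u) i ∧ lookup A u)
  lookup-classPart i A = lookup∘tabulate (λ u → δ (part u) i ∧ lookup A u)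

  ∈classPart⁻ : ∀ {i A u} → u ∈ classPart i A → T (δ (part u) i) × T (lookup A u)
  ∈classPart⁻ {i} {A} {u} u∈X = Equivalence.to T-∧ (subst T (lookup-classPart i A u) (∈⇒T u∈X))

  ∈classPart⁺ : ∀ {i A u} → T (δ (part u) i) → T (lookup A u) → u ∈ classPart i A
  ∈classPart⁺ {i} {A} {u} u∈V u∈A = T⇒∈ (subst T (sym (lookup-classPart i A u)) (Equivalence.from T-∧ (u∈V , u∈A)))

  ∣classPart∣ : ∀ i A → ∣ classPart i A ∣ ≡ ∣ A ∩V i ∣
  ∣classPart∣ i A = trans (∣∣≡∑ (classPart i A)) (sum-cong-≗ (λ u → cong ⟦_⟧ (lookup-classPart i A u)))

  -- If the centre lies in A and |A ∩ Vᵢ| ≥ r, some r-subset of A ∩ Vᵢ through the centre is an edge inside A.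
  independent⇒starFree : 1 ≤ r → ∀ A → T (independentᵇ edgeᵇ A) → ∀ i → starFree i A ≡ true
  independent⇒starFree 1≤r A indep i with lookup A (centre i) in c∈A | big i A in isBig
  ... | false | _ = refl
  ... | true | false = refl
  ... | true | true = contradiction (Equivalence.from T-∧ (⊆⇒T⊆ᵇ e⊆A , e-edge)) (subst T (Equivalence.to T-not-≡ no-edge))
    where
    c = centre i
    X = classPart i A
    c∈X : c ∈ X
    c∈X = ∈classPart⁺ {i} {A} (Equivalence.from T-≡ (δ-centre i)) (Equivalence.from T-≡ c∈A)
    r≤∣X∣ : r ≤ ∣ X ∣
    r≤∣X∣ = subst (r ≤_) (sym (∣classPart∣ i A)) (≤ᵇ⇒≤ r _ (Equivalence.from T-≡ isBig))
    between = ⊆-between r (λ x∈⁅c⁆ → subst (_∈ X) (sym (x∈⁅y⁆⇒x≡y c x∈⁅c⁆)) c∈X) (subst (_≤ r) (sym (∣⁅x⁆∣≡1 c)) 1≤r) r≤∣X∣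
    e = proj₁ between
    c∈e : c ∈ e
    c∈e = proj₁ (proj₂ between) (x∈⁅x⁆ c)
    e⊆X : e ⊆ X
    e⊆X = proj₁ (proj₂ (proj₂ between))
    e⊆A : e ⊆ A
    e⊆A x∈e = T⇒∈ (proj₂ (∈classPart⁻ {i} {A} (e⊆X x∈e)))
    inClass : ∀ v → T (not (lookup e v) ∨ ⌊ part v ≟ i ⌋)
    inClass v with lookup e v in v∈e
    ... | false = tt
    ... | true = proj₁ (∈classPart⁻ {i} {A} (e⊆X (lookup⇒[]= v e v∈e)))
    e-edge : T (edgeᵇ e)
    e-edge = Equivalence.from T-∧ (≡⇒≡ᵇ ∣ e ∣ r (proj₂ (proj₂ (proj₂ between))) ,
      any⁺ _ (Anyₚ.tabulate⁺ i (Equivalence.from T-∧ (∈⇒T c∈e , all⁻ _ (Allₚ.tabulate⁺ inClass)))))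
    no-edge : T (not (e ⊆ᵇ A ∧ edgeᵇ e))
    no-edge = All.lookup (all⁺ _ _ indep) (∈-allSubsets e)

  ∑∣∩V∣≡∣∣ : ∀ A → ∑ (λ i → ∣ A ∩V i ∣) ≡ ∣ A ∣
  ∑∣∩V∣≡∣∣ A = begin
    ∑ (λ i → ∑ (λ u → ⟦ δ (part u) i ∧ lookup A u ⟧))   ≡⟨ ∑-comm (λ i u → ⟦ δ (part u) i ∧ lookup A u ⟧) ⟩
    ∑ (λ u → ∑ (λ i → ⟦ δ (part u) i ∧ lookup A u ⟧))   ≡⟨ sum-cong-≗ vertex-counted-once ⟩
    ∑ (λ u → ⟦ lookup A u ⟧)                            ≡⟨ ∣∣≡∑ A ⟨
    ∣ A ∣                                               ∎
    where
    open ≡-Reasoning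
    vertex-counted-once : ∀ u → ∑ (λ i → ⟦ δ (part u) i ∧ lookup A u ⟧) ≡ ⟦ lookup A u ⟧
    vertex-counted-once u = begin
      ∑ (λ i → ⟦ δ (part u) i ∧ lookup A u ⟧)
        ≡⟨ sum-cong-≗ (λ i → trans (⟦∧⟧ (δ (part u) i) (lookup A u)) (*-comm ⟦ δ (part u) i ⟧ _)) ⟩
      ∑ (λ i → ⟦ lookup A u ⟧ * ⟦ δ (part u) i ⟧)
        ≡⟨ *-distribˡ-sum ⟦ lookup A u ⟧ (λ i → ⟦ δ (part u) i ⟧) ⟨
      ⟦ lookup A u ⟧ * ∑ (λ i → ⟦ δ (part u) i ⟧)
        ≡⟨ cong (_*_ ⟦ lookup A u ⟧) (∑-δ (part u)) ⟩
      ⟦ lookup A u ⟧ * 1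
        ≡⟨ *-identityʳ _ ⟩
      ⟦ lookup A u ⟧ ∎

  1≤∏∣V∣ : 1 ≤ ∏ ∣V_∣
  1≤∏∣V∣ = subst (_≤ ∏ ∣V_∣) (trans (∏-const m 1) (^-zeroˡ m)) (∏-mono 1≤∣V∣)
    where
    1≤∣V∣ : ∀ i → 1 ≤ ∣V i ∣
    1≤∣V∣ i = ≤-trans (≤-reflexive (cong ⟦_⟧ (sym (δ-centre i)))) (∑-single (λ u → ⟦ δ (part u) i ⟧) (centre i))

  numIndep≡∑ₛ : ∀ s → numIndep edgeᵇ s ≡ ∑ₛ d (λ A → ⟦ (∣ A ∣ ≡ᵇ s) ∧ independentᵇ edgeᵇ A ⟧)
  numIndep≡∑ₛ s = trans (length-filterᵇ _ (allSubsets d)) (∑-allSubsets d _)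

  numIndep≤C : ∀ s → numIndep edgeᵇ s ≤ d C s
  numIndep≤C s = begin
    numIndep edgeᵇ s                              ≡⟨ numIndep≡∑ₛ s ⟩
    ∑ₛ d (λ A → ⟦ (∣ A ∣ ≡ᵇ s) ∧ independentᵇ edgeᵇ A ⟧) ≤⟨ ∑ₛ-mono d (λ A → ⟦∧⟧≤ˡ (∣ A ∣ ≡ᵇ s) _) ⟩
    ∑ₛ d (λ A → ⟦ ∣ A ∣ ≡ᵇ s ⟧)                                        ≡⟨ ∑ₛ-∣∣≡ d s ⟩
    d C s                                                              ∎
    where open ≤-Reasoning

  ∏∣V∣*numIndep≤∑ₛ∏avgWeight : 1 ≤ r → ∀ s →
    ∏ ∣V_∣ * numIndep edgeᵇ s ≤ ∑ₛ d (λ A → ⟦ ∣ A ∣ ≡ᵇ s ⟧ * ∏ (λ i → avgWeight i A))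
  ∏∣V∣*numIndep≤∑ₛ∏avgWeight 1≤r s = begin
    ∏ ∣V_∣ * numIndep edgeᵇ s
      ≡⟨ cong (_*_ (∏ ∣V_∣)) (numIndep≡∑ₛ s) ⟩
    ∏ ∣V_∣ * ∑ₛ d (λ A → ⟦ (∣ A ∣ ≡ᵇ s) ∧ independentᵇ edgeᵇ A ⟧)
      ≡⟨ *-distribˡ-∑ₛ d (∏ ∣V_∣) _ ⟩
    ∑ₛ d (λ A → ∏ ∣V_∣ * ⟦ (∣ A ∣ ≡ᵇ s) ∧ independentᵇ edgeᵇ A ⟧)
      ≤⟨ ∑ₛ-mono d (λ A → pointwise A (∣ A ∣ ≡ᵇ s) (independentᵇ edgeᵇ A) refl) ⟩
    ∑ₛ d (λ A → ⟦ ∣ A ∣ ≡ᵇ s ⟧ * ∏ (λ i → freeWeight i A))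
      ≡⟨ ∑ₛ-∏freeWeight≡∑ₛ-∏avgWeight _ w-swap ⟩
    ∑ₛ d (λ A → ⟦ ∣ A ∣ ≡ᵇ s ⟧ * ∏ (λ i → avgWeight i A)) ∎
    where
    open ≤-Reasoning
    w-swap : ∀ k → SwapInvariant k (λ A → ⟦ ∣ A ∣ ≡ᵇ s ⟧)
    w-swap k v A part-v = cong (λ n → ⟦ n ≡ᵇ s ⟧) (∣swap∣ part-v A)
    pointwise : ∀ A x b → independentᵇ edgeᵇ A ≡ b → ∏ ∣V_∣ * ⟦ x ∧ b ⟧ ≤ ⟦ x ⟧ * ∏ (λ i → freeWeight i A)
    pointwise A false b _ = ≤-reflexive (*-zeroʳ (∏ ∣V_∣))
    pointwise A true false _ = ≤-trans (≤-reflexive (*-zeroʳ (∏ ∣V_∣))) z≤n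
    pointwise A true true indep = ≤-reflexive (begin-equality
      ∏ ∣V_∣ * 1
        ≡⟨ *-identityʳ (∏ ∣V_∣) ⟩
      ∏ ∣V_∣
        ≡⟨ ∏-cong (λ i → trans (sym (*-identityʳ ∣V i ∣)) (cong (λ b → ∣V i ∣ * ⟦ b ⟧) (sym (free i)))) ⟩
      ∏ (λ i → freeWeight i A)
        ≡⟨ *-identityˡ _ ⟨
      1 * ∏ (λ i → freeWeight i A) ∎)
      where
      free = independent⇒starFree 1≤r A (Equivalence.from T-≡ indep)

  module _ {q} (1≤q : 1 ≤ q) (∣V∣≤1+q : ∀ i → ∣V i ∣ ≤ suc q) (q*m≤d : q * m ≤ d) where

    ∏avgWeight-bound : ∀ A → r * m ≤ ∣ A ∣ →
      ∏ (λ i → avgWeight i A) ^ (2 * d) * 3 ^ (m * (∣ A ∣ ∸ r * m)) ≤ ∏ ∣V_∣ ^ (2 * d)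
    ∏avgWeight-bound A rm≤∣A∣ = ^*≤^-raise P≤D 2qm≤2d
      (subst (λ z → P ^ (2 * q * m) * z ≤ D ^ (2 * q * m)) (trans (^-*-assoc 3 t m) (cong (3 ^_) (*-comm t m))) (^*≤^-pow (2 * q) m per-class-product))
      where
      open ≤-Reasoning
      P D t : ℕ
      P = ∏ (λ i → avgWeight i A)
      D = ∏ ∣V_∣
      t = ∣ A ∣ ∸ r * m
      P≤D : P ≤ D
      P≤D = ∏-mono (λ i → m∸n≤m ∣V i ∣ (if big i A then ∣ A ∩V i ∣ else 0))
      2qm≤2d : 2 * q * m ≤ 2 * d
      2qm≤2d = subst (_≤ 2 * d) (sym (*-assoc 2 q m)) (*-monoʳ-≤ 2 q*m≤d)
      per-class-product : P ^ (2 * q) * 3 ^ t ≤ D ^ (2 * q)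
      per-class-product = *-cancelʳ-≤ _ _ (3 ^ (r * m)) {{m^n≢0 3 (r * m)}} (begin
        P ^ (2 * q) * 3 ^ t * 3 ^ (r * m)
          ≡⟨ *-assoc (P ^ (2 * q)) (3 ^ t) _ ⟩
        P ^ (2 * q) * (3 ^ t * 3 ^ (r * m))
          ≡⟨ cong (_*_ (P ^ (2 * q))) (^-distribˡ-+-* 3 t (r * m)) ⟨
        P ^ (2 * q) * 3 ^ (t + r * m)
          ≡⟨ cong (λ e → P ^ (2 * q) * 3 ^ e) (trans (m∸n+n≡m rm≤∣A∣) (sym (∑∣∩V∣≡∣∣ A))) ⟩
        P ^ (2 * q) * 3 ^ ∑ (λ i → ∣ A ∩V i ∣)
          ≡⟨ cong₂ _*_ (∏-^ (λ i → avgWeight i A) (2 * q)) (∏-^-∑ 3 (λ i → ∣ A ∩V i ∣)) ⟨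
        ∏ (λ i → avgWeight i A ^ (2 * q)) * ∏ (λ i → 3 ^ ∣ A ∩V i ∣)
          ≡⟨ ∏-distrib-* (λ i → avgWeight i A ^ (2 * q)) _ ⟨
        ∏ (λ i → avgWeight i A ^ (2 * q) * 3 ^ ∣ A ∩V i ∣)
          ≤⟨ ∏-mono (λ i → [n∸L]^2q*3^a≤n^2q*3^r r 1≤q (∣∩V∣≤∣V∣ A i) (∣V∣≤1+q i)) ⟩
        ∏ (λ i → ∣V i ∣ ^ (2 * q) * 3 ^ r)
          ≡⟨ ∏-distrib-* (λ i → ∣V i ∣ ^ (2 * q)) (λ _ → 3 ^ r) ⟩
        ∏ (λ i → ∣V i ∣ ^ (2 * q)) * ∏ {m} (λ _ → 3 ^ r)
          ≡⟨ cong₂ _*_ (∏-^ ∣V_∣ (2 * q)) (trans (∏-const m (3 ^ r)) (^-*-assoc 3 r m)) ⟩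
        D ^ (2 * q) * 3 ^ (r * m) ∎)

    numIndep-bound : 1 ≤ r → 1 ≤ d → ∀ s → r * m ≤ s →
      numIndep edgeᵇ s ^ (2 * d) * 3 ^ (m * (s ∸ r * m)) ≤ (d C s) ^ (2 * d)
    numIndep-bound 1≤r 1≤d s rm≤s = *-cancelˡ-≤ (D ^ (2 * d)) {{m^n≢0 D (2 * d) {{>-nonZero 1≤∏∣V∣}}}} (begin
      D ^ (2 * d) * (N ^ (2 * d) * K)
        ≡⟨ *-assoc (D ^ (2 * d)) _ K ⟨
      D ^ (2 * d) * N ^ (2 * d) * K
        ≡⟨ cong (_* K) (^-distribʳ-* D N (2 * d)) ⟨
      (D * N) ^ (2 * d) * K
        ≤⟨ *-monoˡ-≤ K (^-monoˡ-≤ (2 * d) (∏∣V∣*numIndep≤∑ₛ∏avgWeight 1≤r s)) ⟩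
      ∑ₛ d (λ A → ⟦ ∣ A ∣ ≡ᵇ s ⟧ * ∏ (λ i → avgWeight i A)) ^ (2 * d) * K
        ≤⟨ ∑ₛ-preserves-^*≤^ d (2 * d) (m^n>0 3 (m * (s ∸ r * m))) (λ A → ⟦⟧*-^*≤^ (∣ A ∣ ≡ᵇ s) 1≤2d (per-set A)) ⟩
      ∑ₛ d (λ A → ⟦ ∣ A ∣ ≡ᵇ s ⟧ * D) ^ (2 * d)
        ≡⟨ cong (_^ (2 * d)) ∑ₛ-D ⟩
      (D * (d C s)) ^ (2 * d)
        ≡⟨ ^-distribʳ-* D (d C s) (2 * d) ⟩
      D ^ (2 * d) * (d C s) ^ (2 * d) ∎)
      where
      open ≤-Reasoning
      D = ∏ ∣V_∣
      N = numIndep edgeᵇ s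
      K = 3 ^ (m * (s ∸ r * m))
      1≤2d : 1 ≤ 2 * d
      1≤2d = ≤-trans 1≤d (m≤m+n d _)
      per-set : ∀ A → T (∣ A ∣ ≡ᵇ s) → ∏ (λ i → avgWeight i A) ^ (2 * d) * K ≤ D ^ (2 * d)
      per-set A ∣A∣≡ᵇs with ≡ᵇ⇒≡ ∣ A ∣ s ∣A∣≡ᵇs
      ... | refl = ∏avgWeight-bound A rm≤s
      ∑ₛ-D : ∑ₛ d (λ A → ⟦ ∣ A ∣ ≡ᵇ s ⟧ * D) ≡ D * (d C s)
      ∑ₛ-D = begin-equality
        ∑ₛ d (λ A → ⟦ ∣ A ∣ ≡ᵇ s ⟧ * D)   ≡⟨ ∑ₛ-cong d (λ A → *-comm _ D) ⟩
        ∑ₛ d (λ A → D * ⟦ ∣ A ∣ ≡ᵇ s ⟧)   ≡⟨ *-distribˡ-∑ₛ d D _ ⟨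
        D * ∑ₛ d (λ A → ⟦ ∣ A ∣ ≡ᵇ s ⟧)   ≡⟨ cong (_*_ D) (∑ₛ-∣∣≡ d s) ⟩
        D * (d C s)                        ∎

lemma5 : (r d m : ℕ) → .{{_ : NonZero m}} → 2 ≤ r → m ≤ d →
    (part : Fin d → Fin m) (centre : Fin m → Fin d) →
    (∀ i → part (centre i) ≡ i) →
    (∀ i → (classSize part i ≡ d / m) ⊎ (classSize part i ≡ ⌈ d / m ⌉)) →
    (s : ℕ) → s ≤ d →
    LeExp (numIndep (starsEdgeᵇ r part centre) s ^ (2 * d)) ((d C s) ^ (2 * d))
          (- (+ m *ℤ (+ s -ℤ + (r * m))))
lemma5 r d m 2≤r m≤d part centre part∘centre balanced s _ with ≤-total s (r * m)
... | inj₁ s≤rm = subst (LeExp _ _) (sym (-[m*[s-t]]≡+[m*[t∸s]] m s≤rm))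
  (LeExp-+ (m * (r * m ∸ s)) (^-monoˡ-≤ (2 * d) (numIndep≤C s)))
  where open Stars r part centre part∘centre
... | inj₂ rm≤s = subst (LeExp _ _) (sym (-[m*[s-t]]≡-[m*[s∸t]] m rm≤s))
  (LeExp-- _ (numIndep-bound (m≥n⇒m/n>0 m≤d) ∣V∣≤1+q (m/n*n≤m d m) 1≤r 1≤d s rm≤s))
  where
  open Stars r part centre part∘centre
  1≤r : 1 ≤ r
  1≤r = ≤-trans (n≤1+n 1) 2≤r
  1≤d : 1 ≤ d
  1≤d = ≤-trans (>-nonZero⁻¹ m) m≤d
  ∣V∣≤1+q : ∀ i → ∣V i ∣ ≤ suc (d / m)
  ∣V∣≤1+q i with balanced i
  ... | inj₁ ≡⌊d/m⌋ = subst (_≤ suc (d / m)) (trans (sym ≡⌊d/m⌋) (classSize≡∣V∣ i)) (n≤1+n (d / m))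
  ... | inj₂ ≡⌈d/m⌉ = subst (_≤ suc (d / m)) (trans (sym ≡⌈d/m⌉) (classSize≡∣V∣ i)) (⌈/⌉≤1+/ d m)
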